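{- Let $r\ge2$ and let $p,q$ be positive integers with $p>1$ or $q>1$. Let $F$ be the $1\times(p+q)$ matrix consisting of $p$ entries equal to $0$ followed by $q$ entries equal to $1$. Then $\mathrm{forb}(m,r,\mathrm{Sym}(F))=\Theta(m)$.
   Context: An $r$-matrix is a matrix with entries in $\{0,1,\dots,r-1\}$; a matrix is simple if it has no repeated columns. $F\prec A$ means some submatrix of $A$ is a row and column permutation of $F$. $\mathrm{forb}(m,r,\mathcal F)$ is the maximum number of columns of a simple $m$-rowed $r$-matrix $A$ with $F\not\prec A$ for all $F\in\mathcal F$. For a $(0,1)$-matrix $F$, $F(i,j)$ replaces each $0$ by $i$ and each $1$ by $j$; $\mathrm{Sym}(F)=\{F(i,j):0\le i<j\le r-1\}$. Asymptotics are as $m\to\infty$ with $r,p,q$ fixed. -}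

module Defs where

open import Data.Nat using (ℕ; _≤_; _<_; _*_)
open import Data.Fin using (Fin; splitAt) renaming (_<_ to _<ᶠ_)
open import Data.Sum using (_⊎_; [_,_])
open import Data.Product using (Σ; _×_)
open import Function using (const)
open import Function.Definitions using (Injective)
open import Relation.Binary.PropositionalEquality using (_≡_)
open import Relation.Nullary using (¬_)

Matrix : ℕ → ℕ → ℕ → Set
Matrix r m n = Fin m → Fin n → Fin r

Simple : ∀ {r m n} → Matrix r m n → Set
Simple {m = m} {n = n} A = (j k : Fin n) → ((i : Fin m) → A i j ≡ A i k) → j ≡ k

-- F ≺ A: some submatrix of A is a row and column permutation of F, i.e.
-- there are injective row and column maps placing F inside A.
_≺_ : ∀ {r k l m n} → Matrix r k l → Matrix r m n → Set
_≺_ {k = k} {l = l} {m = m} {n = n} F A =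
  Σ (Fin k → Fin m) λ ρ → Σ (Fin l → Fin n) λ γ →
    Injective _≡_ _≡_ ρ × Injective _≡_ _≡_ γ ×
    ((i : Fin k) (j : Fin l) → A (ρ i) (γ j) ≡ F i j)

-- F(a,b) for the 1×(p+q) matrix F = [0…0 1…1] (p zeros then q ones):
-- the first p entries are a, the last q entries are b.
Fab : ∀ {r} (p q : ℕ) → Fin r → Fin r → Matrix r 1 (p Data.Nat.+ q)
Fab p q a b _ t = [ const a , const b ] (splitAt p t)

-- A avoids every member of Sym(F) = { F(a,b) : 0 ≤ a < b ≤ r-1 }.
AvoidsSym : ∀ {r m n} (p q : ℕ) → Matrix r m n → Set
AvoidsSym {r} p q A = (a b : Fin r) → a <ᶠ b → ¬ (Fab p q a b ≺ A)

-- Upper bound (n ≤ 1 + m·r(p+q)).  In a row avoiding every F(a,b) with a < b, two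
-- distinct values cannot both occur p+q or more times (the smaller one would supply
-- the p copies of a, the larger one the q copies of b).  So each row i has a
-- reference value ref i such that every other value occurs fewer than p+q times,
-- i.e. the row deviates from ref i in at most r(p+q) columns.  Every column other
-- than the reference column itself deviates from ref in some row, and a simple
-- matrix has at most one column equal to ref; a union bound over the rows gives the
-- claim.
--
-- Lower bound (n = m).  Take the m×m matrix with x on the diagonal and y elsewhere.
-- Within one row x occurs once, so a value repeated in a copy of F(a,b) is y.  For
-- q > 1 choose (x,y) = (1,0): then b = 0, contradicting a < b; for p > 1 choose
-- (x,y) = (0,1): then a = 1, and b ∈ {0,1} contradicts a < b.
module Submission where

open import Defs
open import Data.Nat using (ℕ; zero; suc; _+_; _*_; _≤_; _<_; z≤n; s≤s; _≤?_; _<?_)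
  renaming (_≟_ to _≟ℕ_)
open import Data.Nat.Properties
  using (≤-refl; ≤-trans; ≤-reflexive; <⇒≤; ≰⇒>; ≤-pred; n≤1+n; +-mono-≤; +-monoˡ-≤;
         +-monoʳ-≤; +-assoc; +-comm; +-identityʳ; *-comm; *-identityˡ; m≤m+n; m≤n+m;
         m<1+n⇒m<n∨m≡n; n≮0; +-commutativeSemigroup)
open import Algebra.Properties.CommutativeSemigroup +-commutativeSemigroup using (interchange)
open import Data.Fin using (Fin; zero; suc; toℕ; fromℕ<; lift; splitAt; join; _↑ˡ_; _↑ʳ_; _≟_)
  renaming (_<_ to _<ᶠ_)
open import Data.Fin.Properties
  using (any?; all?; 0≢1+n; suc-injective; toℕ-injective; toℕ<n; toℕ-fromℕ<; lift-injective;
         <-cmp; <-irrefl; join-splitAt; splitAt-↑ˡ; splitAt-↑ʳ; ↑ˡ-injective; ↑ʳ-injective)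
open import Data.Sum using (_⊎_; inj₁; inj₂; [_,_]′)
open import Data.Product using (Σ; _×_; _,_; proj₁; proj₂)
open import Data.Empty using (⊥; ⊥-elim)
open import Function using (_∘_; id)
open import Function.Definitions using (Injective)
open import Relation.Binary.Definitions using (tri<; tri≈; tri>)
open import Relation.Binary.PropositionalEquality using (_≡_; _≢_; refl; sym; trans; cong; subst)
open import Relation.Nullary using (¬_; Dec; yes; no)
open import Relation.Nullary.Decidable using (¬?; _×-dec_; _→-dec_)
open import Relation.Unary using (Decidable)

indicator : {P : Set} → Dec P → ℕ
indicator (yes _) = 1
indicator (no _)  = 0

count : ∀ {n} {P : Fin n → Set} → Decidable P → ℕ
count {zero}  P? = 0
count {suc n} P? = indicator (P? zero) + count (P? ∘ suc)

count-none : ∀ {n} {P : Fin n → Set} (P? : Decidable P) → (∀ j → ¬ P j) → count P? ≡ 0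
count-none {zero}  P? none = refl
count-none {suc n} P? none with P? zero
... | yes p = ⊥-elim (none zero p)
... | no _  = count-none (P? ∘ suc) (none ∘ suc)

count-all : ∀ {n} {P : Fin n → Set} (P? : Decidable P) → (∀ j → P j) → count P? ≡ n
count-all {zero}  P? all = refl
count-all {suc n} P? all with P? zero
... | yes _   = cong suc (count-all (P? ∘ suc) (all ∘ suc))
... | no ¬p₀  = ⊥-elim (¬p₀ (all zero))

count-∪ : ∀ {n} {P Q R : Fin n → Set} (P? : Decidable P) (Q? : Decidable Q) (R? : Decidable R) →
          (∀ j → P j → Q j ⊎ R j) → count P? ≤ count Q? + count R?
count-∪ {zero}  P? Q? R? P⊆Q∪R = z≤n
count-∪ {suc n} P? Q? R? P⊆Q∪R =
  ≤-trans (+-mono-≤ (indicator-∪ (P? zero) (Q? zero) (R? zero) (P⊆Q∪R zero))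
                    (count-∪ (P? ∘ suc) (Q? ∘ suc) (R? ∘ suc) (P⊆Q∪R ∘ suc)))
          (≤-reflexive (interchange (indicator (Q? zero)) (indicator (R? zero)) _ _))
  where
  indicator-∪ : {P Q R : Set} (P? : Dec P) (Q? : Dec Q) (R? : Dec R) →
                (P → Q ⊎ R) → indicator P? ≤ indicator Q? + indicator R?
  indicator-∪ (no _)  _        _        _     = z≤n
  indicator-∪ (yes _) (yes _)  _        _     = s≤s z≤n
  indicator-∪ (yes _) (no _)   (yes _)  _     = ≤-refl
  indicator-∪ (yes p) (no ¬q)  (no ¬r)  P⊆Q∪R = ⊥-elim ([ ¬q , ¬r ]′ (P⊆Q∪R p))

count-⊆ : ∀ {n} {P Q : Fin n → Set} (P? : Decidable P) (Q? : Decidable Q) →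
          (∀ j → P j → Q j) → count P? ≤ count Q?
count-⊆ P? Q? P⊆Q =
  ≤-trans (count-∪ P? Q? empty? (λ j → inj₁ ∘ P⊆Q j))
          (≤-reflexive (trans (cong (count Q? +_) (count-none empty? (λ _ → id))) (+-identityʳ _)))
  where
  empty? : Decidable (λ _ → ⊥)
  empty? _ = no id

enumerate : ∀ {n} {P : Fin n → Set} (P? : Decidable P) (k : ℕ) → k ≤ count P? →
            Σ (Fin k → Fin n) λ α → Injective _≡_ _≡_ α × (∀ s → P (α s))
enumerate         P? zero    _  = (λ ()) , (λ { {()} }) , (λ ())
enumerate {zero}  P? (suc k) ()
enumerate {suc n} P? (suc k) k<|P| with P? zero
... | yes p₀ with enumerate (P? ∘ suc) k (≤-pred k<|P|)
...   | α , α-inj , Pα = lift 1 α , lift-injective α α-inj 1 , P-lift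
  where
  P-lift : ∀ s → _
  P-lift zero    = p₀
  P-lift (suc s) = Pα s
enumerate {suc n} P? (suc k) k≤|P| | no _ with enumerate (P? ∘ suc) (suc k) k≤|P|
... | α , α-inj , Pα = suc ∘ α , α-inj ∘ suc-injective , Pα

count-≤-from-witness : ∀ {n M} {P : Fin n → Set} (P? : Decidable P) →
                       (∀ j → P j → count P? ≤ M) → count P? ≤ M
count-≤-from-witness P? bound with 1 ≤? count P?
... | no  empty     = ≤-trans (≤-pred (≰⇒> empty)) z≤n
... | yes inhabited with enumerate P? 1 inhabited
...   | α , _ , Pα = bound (α zero) (Pα zero)

count-≤-1 : ∀ {n} {P : Fin n → Set} (P? : Decidable P) →
            (∀ j k → P j → P k → j ≡ k) → count P? ≤ 1
count-≤-1 P? unique with 2 ≤? count P?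
... | no  few  = ≤-pred (≰⇒> few)
... | yes many with enumerate P? 2 many
...   | α , α-inj , Pα with α-inj (unique (α zero) (α (suc zero)) (Pα zero) (Pα (suc zero)))
...     | ()

occurrences : ∀ {r n} → (Fin n → Fin r) → Fin r → ℕ
occurrences w a = count (λ j → w j ≟ a)

-- The row w contains no F(a,b), a < b: no a < b occur p resp. q times.
RowAvoids : ∀ {r n} (p q : ℕ) → (Fin n → Fin r) → Set
RowAvoids p q w = ∀ a b → a <ᶠ b → p ≤ occurrences w a → q ≤ occurrences w b → ⊥

-- At most one value of an avoiding row occurs p+q times or more; so some value v
-- (an arbitrary v₀ if none is frequent) has all other values occurring < p+q times.
dominantValue : ∀ {r n} (p q : ℕ) (w : Fin n → Fin r) → RowAvoids p q w → Fin r →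
                Σ (Fin r) λ v → ∀ a → a ≢ v → occurrences w a < p + q
dominantValue p q w avoids v₀ with any? (λ a → p + q ≤? occurrences w a)
... | no noneFrequent = v₀ , λ a _ → ≰⇒> (λ a-frequent → noneFrequent (a , a-frequent))
... | yes (v , v-frequent) = v , rare
  where
  bothFrequent : ∀ a b → a <ᶠ b → p + q ≤ occurrences w a → p + q ≤ occurrences w b → ⊥
  bothFrequent a b a<b a-frequent b-frequent =
    avoids a b a<b (≤-trans (m≤m+n p q) a-frequent) (≤-trans (m≤n+m q p) b-frequent)

  rare : ∀ a → a ≢ v → occurrences w a < p + q
  rare a a≢v with p + q ≤? occurrences w a
  ... | no  a-rare     = ≰⇒> a-rare
  ... | yes a-frequent with <-cmp a v
  ...   | tri< a<v _ _ = ⊥-elim (bothFrequent a v a<v a-frequent v-frequent)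
  ...   | tri≈ _ a≡v _ = ⊥-elim (a≢v a≡v)
  ...   | tri> _ _ v<a = ⊥-elim (bothFrequent v a v<a v-frequent a-frequent)

-- The positions whose value lies in Q and has index below t
-- gain at most one fibre as t increases by one.
valuesIn-bound : ∀ {r n M} (w : Fin n → Fin r) {Q : Fin r → Set} (Q? : Decidable Q) →
                 (∀ a → Q a → occurrences w a ≤ M) → count (λ j → Q? (w j)) ≤ r * M
valuesIn-bound {r} {n} {M} w {Q} Q? fibre≤M =
  ≤-trans (count-⊆ (λ j → Q? (w j)) (below r) (λ j Qwj → Qwj , toℕ<n (w j))) (below-bound r)
  where
  below : (t : ℕ) → Decidable (λ j → Q (w j) × toℕ (w j) < t)
  below t j = Q? (w j) ×-dec (toℕ (w j) <? t)

  level : (t : ℕ) → Decidable (λ j → Q (w j) × toℕ (w j) ≡ t)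
  level t j = Q? (w j) ×-dec (toℕ (w j) ≟ℕ t)

  -- A nonempty level is contained in the fibre of its value, which lies in Q.
  level-bound : ∀ t → count (level t) ≤ M
  level-bound t = count-≤-from-witness (level t) λ where
    j₀ (Qwj₀ , wj₀≡t) →
      ≤-trans (count-⊆ (level t) (λ j → w j ≟ w j₀)
                       (λ j (_ , wj≡t) → toℕ-injective (trans wj≡t (sym wj₀≡t))))
              (fibre≤M (w j₀) Qwj₀)

  below-bound : ∀ t → count (below t) ≤ t * M
  below-bound zero    = ≤-reflexive (count-none (below zero) (λ j ()))
  below-bound (suc t) =
    ≤-trans (count-∪ (below (suc t)) (below t) (level t) splitLast)
            (≤-trans (+-mono-≤ (below-bound t) (level-bound t)) (≤-reflexive (+-comm (t * M) M)))
    where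
    splitLast : ∀ j → Q (w j) × toℕ (w j) < suc t → _
    splitLast j (Qwj , wj<1+t) with m<1+n⇒m<n∨m≡n wj<1+t
    ... | inj₁ wj<t = inj₁ (Qwj , wj<t)
    ... | inj₂ wj≡t = inj₂ (Qwj , wj≡t)

rowDeviation : ∀ {r n} (p q : ℕ) (w : Fin n → Fin r) → RowAvoids p q w → Fin r →
               Σ (Fin r) λ v → count (λ j → ¬? (w j ≟ v)) ≤ r * (p + q)
rowDeviation p q w avoids v₀ with dominantValue p q w avoids v₀
... | v , othersRare = v , valuesIn-bound w (λ a → ¬? (a ≟ v)) (λ a a≢v → <⇒≤ (othersRare a a≢v))

rowPattern⇒≺ : ∀ {r m n} (p q : ℕ) (A : Matrix r m n) (i : Fin m) {a b : Fin r} → a ≢ b →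
               p ≤ occurrences (A i) a → q ≤ occurrences (A i) b → Fab p q a b ≺ A
rowPattern⇒≺ {n = n} p q A i {a} {b} a≢b p≤#a q≤#b
  with enumerate (λ j → A i j ≟ a) p p≤#a | enumerate (λ j → A i j ≟ b) q q≤#b
... | α , α-inj , Aα | β , β-inj , Aβ = (λ _ → i) , γ , oneRow , γ-inj , entries
  where
  columns : Fin p ⊎ Fin q → Fin n
  columns = [ α , β ]′

  columns-inj : ∀ u u' → columns u ≡ columns u' → u ≡ u'
  columns-inj (inj₁ s) (inj₁ s') e = cong inj₁ (α-inj e)
  columns-inj (inj₁ s) (inj₂ s') e = ⊥-elim (a≢b (trans (sym (Aα s)) (trans (cong (A i) e) (Aβ s'))))
  columns-inj (inj₂ s) (inj₁ s') e = ⊥-elim (a≢b (trans (sym (Aα s')) (trans (cong (A i) (sym e)) (Aβ s))))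
  columns-inj (inj₂ s) (inj₂ s') e = cong inj₂ (β-inj e)

  γ : Fin (p + q) → Fin n
  γ = columns ∘ splitAt p

  oneRow : Injective _≡_ _≡_ (λ (_ : Fin 1) → i)
  oneRow {zero} {zero} _ = refl

  γ-inj : Injective _≡_ _≡_ γ
  γ-inj {t} {t'} e = trans (sym (join-splitAt p q t))
    (trans (cong (join p q) (columns-inj (splitAt p t) (splitAt p t') e)) (join-splitAt p q t'))

  entries : (x : Fin 1) (t : Fin (p + q)) → A i (γ t) ≡ Fab p q a b x t
  entries x t with splitAt p t
  ... | inj₁ s = Aα s
  ... | inj₂ s = Aβ s

-- All columns but the reference column
-- itself differ from ref somewhere; a union bound over the rows.
module ColumnBound {r m n : ℕ} (A : Matrix r m n) (ref : Fin m → Fin r) where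

  agreesUpTo : (k : ℕ) → Decidable (λ j → ∀ i → toℕ i < k → A i j ≡ ref i)
  agreesUpTo k j = all? (λ i → (toℕ i <? k) →-dec (A i j ≟ ref i))

  deviates : (i : Fin m) → Decidable (λ j → A i j ≢ ref i)
  deviates i j = ¬? (A i j ≟ ref i)

  agrees-step : ∀ k (k<m : k < m) j → (∀ i → toℕ i < k → A i j ≡ ref i) →
                (∀ i → toℕ i < suc k → A i j ≡ ref i) ⊎ A (fromℕ< k<m) j ≢ ref (fromℕ< k<m)
  agrees-step k k<m j agrees with A (fromℕ< k<m) j ≟ ref (fromℕ< k<m)
  ... | no  deviation = inj₂ deviation
  ... | yes rowK      = inj₁ agrees′
    where
    agrees′ : ∀ i → toℕ i < suc k → A i j ≡ ref i
    agrees′ i i<1+k with m<1+n⇒m<n∨m≡n i<1+k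
    ... | inj₁ i<k = agrees i i<k
    ... | inj₂ i≡k = subst (λ i′ → A i′ j ≡ ref i′)
                           (toℕ-injective (trans (toℕ-fromℕ< k<m) (sym i≡k))) rowK

  module _ (K : ℕ) (deviation≤K : ∀ i → count (deviates i) ≤ K) where

    -- Invariant: the columns not yet accounted for agree with ref on the first k rows.
    agrees-bound : ∀ k → k ≤ m → n ≤ count (agreesUpTo k) + k * K
    agrees-bound zero    _     =
      ≤-reflexive (sym (trans (+-identityʳ _) (count-all (agreesUpTo zero) (λ j i ()))))
    agrees-bound (suc k) 1+k≤m =
      ≤-trans (agrees-bound k (≤-trans (n≤1+n k) 1+k≤m))
      (≤-trans (+-monoˡ-≤ (k * K) (count-∪ (agreesUpTo k) (agreesUpTo (suc k)) (deviates rowK)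
                                           (agrees-step k 1+k≤m)))
      (≤-trans (≤-reflexive (+-assoc (count (agreesUpTo (suc k))) _ _))
               (+-monoʳ-≤ (count (agreesUpTo (suc k))) (+-monoˡ-≤ (k * K) (deviation≤K rowK)))))
      where
      rowK : Fin m
      rowK = fromℕ< 1+k≤m

    columnBound : Simple A → n ≤ 1 + m * K
    columnBound simple =
      ≤-trans (agrees-bound m ≤-refl) (+-monoˡ-≤ (m * K) (count-≤-1 (agreesUpTo m) sameColumn))
      where
      sameColumn : ∀ j k → (∀ i → toℕ i < m → A i j ≡ ref i) →
                   (∀ i → toℕ i < m → A i k ≡ ref i) → j ≡ k
      sameColumn j k j≈ref k≈ref =
        simple j k (λ i → trans (j≈ref i (toℕ<n i)) (sym (k≈ref i (toℕ<n i))))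

upperBound : ∀ {r m n} (p q : ℕ) (A : Matrix r m n) → Fin r → Simple A → AvoidsSym p q A →
             n ≤ 1 + m * (r * (p + q))
upperBound {r} p q A v₀ simple avoids =
  ColumnBound.columnBound A (proj₁ ∘ deviation) (r * (p + q)) (proj₂ ∘ deviation) simple
  where
  rowAvoids : ∀ i → RowAvoids p q (A i)
  rowAvoids i a b a<b p≤#a q≤#b =
    avoids a b a<b (rowPattern⇒≺ p q A i (λ a≡b → <-irrefl a≡b a<b) p≤#a q≤#b)

  deviation : ∀ i → Σ (Fin r) λ v → count (λ j → ¬? (A i j ≟ v)) ≤ r * (p + q)
  deviation i = rowDeviation p q (A i) (rowAvoids i) v₀

diagonal : ∀ {r m} → Fin r → Fin r → Matrix r m m
diagonal x y i j with i ≟ j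
... | yes _ = x
... | no  _ = y

module Diagonal {r m : ℕ} {x y : Fin r} (x≢y : x ≢ y) where

  diagonal-values : ∀ (i j : Fin m) → diagonal x y i j ≡ x ⊎ diagonal x y i j ≡ y
  diagonal-values i j with i ≟ j
  ... | yes _ = inj₁ refl
  ... | no  _ = inj₂ refl

  x-on-diagonal : ∀ (i j : Fin m) → diagonal x y i j ≡ x → i ≡ j
  x-on-diagonal i j e with i ≟ j
  ... | yes i≡j = i≡j
  ... | no  _   = ⊥-elim (x≢y (sym e))

  diagonal-self : ∀ j → diagonal {m = m} x y j j ≡ x
  diagonal-self j with j ≟ j
  ... | yes _ = refl
  ... | no  j≢j = ⊥-elim (j≢j refl)

  -- Column j is the only column with x in row j.
  diagonal-simple : Simple (diagonal {m = m} x y)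
  diagonal-simple j k same = x-on-diagonal j k (trans (sym (same j)) (diagonal-self j))

  -- In a one-rowed pattern contained in the diagonal matrix, all entries are x or y,
  -- and an entry occurring at two positions is y (x occurs once per row).
  module _ {l : ℕ} {F : Matrix r 1 l} where

    pattern-values : F ≺ diagonal {m = m} x y → ∀ t → F zero t ≡ x ⊎ F zero t ≡ y
    pattern-values (ρ , γ , _ , _ , entries) t with diagonal-values (ρ zero) (γ t)
    ... | inj₁ e = inj₁ (trans (sym (entries zero t)) e)
    ... | inj₂ e = inj₂ (trans (sym (entries zero t)) e)

    repeated-is-y : F ≺ diagonal {m = m} x y → ∀ t₁ t₂ → t₁ ≢ t₂ →
                    F zero t₁ ≡ F zero t₂ → F zero t₁ ≡ y
    repeated-is-y F≺D@(_ , γ , _ , γ-inj , entries) t₁ t₂ t₁≢t₂ same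
      with pattern-values F≺D t₁
    ... | inj₂ Ft₁≡y = Ft₁≡y
    ... | inj₁ Ft₁≡x = ⊥-elim (t₁≢t₂ (γ-inj (trans (sym (onDiagonal t₁ Ft₁≡x))
                                                  (onDiagonal t₂ (trans (sym same) Ft₁≡x)))))
      where
      -- A position of F carrying x is placed in the diagonal column of the pattern row.
      onDiagonal : ∀ t → F zero t ≡ x → _ ≡ γ t
      onDiagonal t Ft≡x = x-on-diagonal _ _ (trans (entries zero t) Ft≡x)

Fab-left : ∀ {r} p q (a b : Fin r) (s : Fin p) → Fab p q a b zero (s ↑ˡ q) ≡ a
Fab-left p q a b s rewrite splitAt-↑ˡ p s q = refl

Fab-right : ∀ {r} p q (a b : Fin r) (s : Fin q) → Fab p q a b zero (p ↑ʳ s) ≡ b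
Fab-right p q a b s rewrite splitAt-↑ʳ p q s = refl

-- For q ≥ 2, the diagonal matrix with 1 on the diagonal and 0 elsewhere avoids Sym(F):
-- the repeated value b would be 0, but b > a ≥ 0.
avoids-q≥2 : ∀ {r m} p q → AvoidsSym p (suc (suc q)) (diagonal {suc (suc r)} {m} (suc zero) zero)
avoids-q≥2 p q a b a<b F≺D = b≢0 (trans (sym (Fab-right p (suc (suc q)) a b zero)) repeated≡0)
  where
  repeated≡0 : Fab p (suc (suc q)) a b zero (p ↑ʳ zero) ≡ zero
  repeated≡0 = Diagonal.repeated-is-y (λ ()) F≺D (p ↑ʳ zero) (p ↑ʳ suc zero)
    (0≢1+n ∘ ↑ʳ-injective p zero (suc zero))
    (trans (Fab-right p (suc (suc q)) a b zero) (sym (Fab-right p (suc (suc q)) a b (suc zero))))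

  b≢0 : b ≢ zero
  b≢0 b≡0 = n≮0 (subst (a <ᶠ_) b≡0 a<b)

-- For p ≥ 2, the diagonal matrix with 0 on the diagonal and 1 elsewhere avoids Sym(F):
-- the repeated value a would be 1, but then no value b ∈ {0,1} exceeds it.
avoids-p≥2 : ∀ {r m} p q → AvoidsSym (suc (suc p)) (suc q) (diagonal {suc (suc r)} {m} zero (suc zero))
avoids-p≥2 {r} p q a b a<b F≺D =
  noLarger (trans (sym (F-a zero)) repeated≡1) b-value
  where
  b-value : b ≡ zero ⊎ b ≡ suc zero
  b-value = subst (λ v → v ≡ zero ⊎ v ≡ suc zero) (Fab-right (suc (suc p)) (suc q) a b zero)
                  (Diagonal.pattern-values (λ ()) F≺D (suc (suc p) ↑ʳ zero))

  left : Fin (suc (suc p)) → Fin (suc (suc p) + suc q)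
  left s = s ↑ˡ suc q

  F-a : (s : Fin (suc (suc p))) → Fab (suc (suc p)) (suc q) a b zero (left s) ≡ a
  F-a s = Fab-left (suc (suc p)) (suc q) a b s

  repeated≡1 : Fab (suc (suc p)) (suc q) a b zero (left zero) ≡ suc zero
  repeated≡1 = Diagonal.repeated-is-y (λ ()) F≺D (left zero) (left (suc zero))
    (0≢1+n ∘ ↑ˡ-injective (suc q) zero (suc zero))
    (trans (F-a zero) (sym (F-a (suc zero))))

  noLarger : a ≡ suc zero → b ≡ zero ⊎ b ≡ suc zero → ⊥
  noLarger refl (inj₁ refl) = n≮0 a<b
  noLarger refl (inj₂ refl) = <-irrefl {n = suc (suc r)} refl a<b

lowerBound : (r p q : ℕ) → 2 ≤ r → 1 ≤ q → (1 < p ⊎ 1 < q) → (m : ℕ) →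
             Σ ℕ λ n → Σ (Matrix r m n) λ A → Simple A × AvoidsSym p q A × m ≤ 1 * n
lowerBound (suc (suc r)) (suc (suc p)) (suc q) (s≤s (s≤s _)) _ (inj₁ _) m =
  m , diagonal zero (suc zero) , Diagonal.diagonal-simple (λ ()) , avoids-p≥2 p q ,
  ≤-reflexive (sym (*-identityˡ m))
lowerBound (suc (suc r)) p (suc (suc q)) (s≤s (s≤s _)) _ (inj₂ _) m =
  m , diagonal (suc zero) zero , Diagonal.diagonal-simple (λ ()) , avoids-q≥2 p q ,
  ≤-reflexive (sym (*-identityˡ m))
lowerBound (suc (suc r)) (suc zero) _    (s≤s (s≤s _)) _ (inj₁ (s≤s ())) m
lowerBound (suc (suc r)) _ (suc zero)    (s≤s (s≤s _)) _ (inj₂ (s≤s ())) m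

mainTheorem18 : (r p q : ℕ) → 2 ≤ r → 1 ≤ p → 1 ≤ q → (1 < p ⊎ 1 < q) →
    Σ ℕ λ c → Σ ℕ λ d → Σ ℕ λ M → 1 ≤ d ×
      ((m : ℕ) → M ≤ m →
        ((n : ℕ) (A : Matrix r m n) → Simple A → AvoidsSym p q A → n ≤ c * m)
        × (Σ ℕ λ n → Σ (Matrix r m n) λ A → Simple A × AvoidsSym p q A × m ≤ d * n))
mainTheorem18 r@(suc (suc _)) p q 2≤r@(s≤s (s≤s _)) _ 1≤q p>1⊎q>1 =
  suc K , 1 , 1 , ≤-refl , λ m 1≤m →
    (λ n A simple avoids →
       -- 1 + m·K ≤ m + K·m = (1 + K)·m
       ≤-trans (upperBound p q A zero simple avoids) (+-mono-≤ 1≤m (≤-reflexive (*-comm m K))))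
    , lowerBound r p q 2≤r 1≤q p>1⊎q>1 m
  where
  K : ℕ
  K = r * (p + q)
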